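{- Let $r\ge2$ and $\mathbf a=(a_2,\dots,a_r)\in\mathbb R^{r-1}$ with $a_r\ne0$. The free $R$-transform of the sequence $(c_n(\mathbf a))_{n\ge0}$ is $$R_{\mathbf a}(z)=\frac{a_2z+\dots+a_rz^{r-1}}{1-a_2z-\dots-a_rz^{r-1}}.$$
   Context: The sequence $c_n(\mathbf a)$ is defined by $c_0(\mathbf a)=1$ and, for $n\ge1$, $c_n(\mathbf a)=\sum_{j=2}^r a_j\sum_{u_1+\dots+u_j=n-j+1,\ u_i\ge0}c_{u_1}(\mathbf a)\cdots c_{u_j}(\mathbf a)$; $C_{\mathbf a}(z)=\sum_{n\ge0}c_n(\mathbf a)z^n$. For a sequence $1=c_0,c_1,c_2,\dots$ with generating (formal power) series $C(z)=\sum_n c_nz^n$, its free $R$-transform is the formal power series $R(z)=\sum_{n\ge1}\kappa_nz^n$ (without constant term) determined by $1+R(zC(z))=C(z)$; the coefficients $\kappa_n$ are the free cumulants. -}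

module Defs where

open import Level using (Level)
open import Data.Nat using (ℕ; zero; suc; _∸_; _≤ᵇ_)
open import Data.Bool using (if_then_else_)
open import Data.Product using (_×_)
open import Algebra.Bundles using (CommutativeRing)

module _ {c ℓ : Level} (R : CommutativeRing c ℓ) where
  open CommutativeRing R

  Series : Set c
  Series = ℕ → Carrier

  Σ< : ℕ → (ℕ → Carrier) → Carrier
  Σ< zero    f = 0#
  Σ< (suc n) f = Σ< n f + f n

  oneS : Series
  oneS zero    = 1#
  oneS (suc _) = 0#

  _⊛_ : Series → Series → Series
  (f ⊛ g) n = Σ< (suc n) (λ i → f i * g (n ∸ i))

  powS : Series → ℕ → Series
  powS F zero    = oneS
  powS F (suc k) = F ⊛ powS F k

  zTimes : Series → Series
  zTimes F zero    = 0#
  zTimes F (suc n) = F n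

  -- composition Q(F(z)) = Σ_k Q_k F(z)^k, for F with zero constant term
  -- (then only k ≤ n contributes to the coefficient of z^n)
  compose : Series → Series → Series
  compose Q F n = Σ< (suc n) (λ k → Q k * powS F k n)

  -- Q is the free R-transform of the sequence with generating series C:
  -- Q has no constant term and 1 + Q(z C(z)) = C(z) (coefficientwise).
  IsRTransform : Series → Series → Set ℓ
  IsRTransform C Q = (Q 0 ≈ 0#) × (∀ n → oneS n + compose Q (zTimes C) n ≈ C n)

  -- The parameters a = (a_2,...,a_r) are given as a : ℕ → Carrier; only the
  -- values a 2, ..., a r are ever used.

  -- One step of the recursion: given g whose coefficients g_0..g_{N-1} are
  -- c_0..c_{N-1}, compute
  --   c_N = Σ_{j=2}^r a_j Σ_{u_1+...+u_j = N-j+1} g_{u_1}...g_{u_j}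
  --       = Σ_{j=2}^r a_j [z^{N-j+1}] g(z)^j    (empty inner sum if j > N+1).
  cStep : (r : ℕ) → (ℕ → Carrier) → Series → ℕ → Carrier
  cStep r a g N = Σ< (r ∸ 1) (λ i → a (suc (suc i)) * inner (suc (suc i)))
    where
    inner : ℕ → Carrier
    inner j = if j ≤ᵇ suc N then powS g j (suc N ∸ j) else 0#

  -- cTab n agrees with c_0, ..., c_n at indices 0..n.
  cTab : (r : ℕ) → (ℕ → Carrier) → ℕ → Series
  cTab r a zero    = oneS
  cTab r a (suc n) m = if m ≤ᵇ n then cTab r a n m else cStep r a (cTab r a n) (suc n)

  cSeq : (r : ℕ) → (ℕ → Carrier) → Series
  cSeq r a n = cTab r a n n

  -- P(z) = a_2 z + a_3 z^2 + ... + a_r z^{r-1}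
  Pa : (r : ℕ) → (ℕ → Carrier) → Series
  Pa r a zero    = 0#
  Pa r a (suc m) = if suc (suc m) ≤ᵇ r then a (suc (suc m)) else 0#

  -- R_a(z) = P(z) / (1 - P(z)) = Σ_{k≥1} P(z)^k ; since P has no constant
  -- term, the coefficient of z^n is Σ_{k=1}^{n} [z^n] P^k.
  Ra : (r : ℕ) → (ℕ → Carrier) → Series
  Ra r a n = Σ< n (λ k → powS (Pa r a) (suc k) n)

-- Put W = z C(z) and Q = P(W) with P(z) = a₂ z + ⋯ + a_r z^{r-1}. The recursion
-- defining c_n says exactly C = 1 + C Q, so C - 1 solves X = Q + Q X. On the other
-- hand R_a = Σ_{k≥1} P^k solves R = P + P R, and substituting W is a ring
-- homomorphism, so R_a(W) solves the same equation. As Q has no constant term, the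
-- coefficient of z^m in Q + Q X only involves lower coefficients of X, so this
-- equation has a unique solution: R_a(z C(z)) = C(z) - 1.
module Submission where

open import Defs
open import Data.Nat using (ℕ; _≤_)
open import Relation.Nullary using (¬_)
open import Algebra.Bundles using (CommutativeRing)

open import Level using (Level)
open import Data.Bool using (Bool; true; false; T; if_then_else_)
open import Data.Empty using (⊥-elim)
open import Data.Nat using (zero; suc; _∸_; _<_; _≤′_; _≤ᵇ_; _<ᵇ_; z≤n; s≤s; ≤′-refl; ≤′-step)
  renaming (_+_ to _+ℕ_)
open import Data.Nat.Properties
  using ( ≤-refl; ≤-trans; ≤-reflexive; ≤-pred; ≤-total; <⇒≤; <-≤-trans; m<n⇒m<1+n; n≤1+n
        ; ≤⇒≤′; ≤′⇒≤; ≤⇒≯; <⇒≱; n≮n; +-monoˡ-≤; ∸-monoʳ-<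
        ; m∸n≤m; m∸n+n≡m; m+[n∸m]≡n; ∸-+-assoc; +-∸-assoc; n∸n≡0; m∸[m∸n]≡n
        ; ≤ᵇ⇒≤; ≤⇒≤ᵇ; <ᵇ⇒<; <⇒<ᵇ )
open import Data.Nat.Induction using (<-rec)
open import Data.Product using (_,_)
open import Data.Sum using (inj₁; inj₂)
open import Function using (_∘_)
open import Relation.Binary.PropositionalEquality as ≡ using (_≡_)
import Algebra.Properties.CommutativeSemigroup as CommutativeSemigroupProperties
import Algebra.Properties.Group as GroupProperties
import Relation.Binary.Reasoning.Setoid as SetoidReasoning

if-true : ∀ {a} {A : Set a} {b : Bool} {x y : A} → T b → (if b then x else y) ≡ x
if-true {b = true} _ = ≡.refl

if-false : ∀ {a} {A : Set a} {b : Bool} {x y : A} → ¬ T b → (if b then x else y) ≡ y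
if-false {b = false} _   = ≡.refl
if-false {b = true}  ¬tt = ⊥-elim (¬tt _)

≤ᵇ≡<ᵇ-suc : ∀ k m → (k ≤ᵇ m) ≡ (k <ᵇ suc m)
≤ᵇ≡<ᵇ-suc zero    m = ≡.refl
≤ᵇ≡<ᵇ-suc (suc k) m = ≡.refl

m∸1+n<m : ∀ {m n} → n < m → m ∸ suc n < m
m∸1+n<m {m} n<m = ∸-monoʳ-< {m} (s≤s z≤n) n<m

module FormalPowerSeries {c ℓ : Level} (R : CommutativeRing c ℓ) where
  open CommutativeRing R
  open SetoidReasoning setoid
  open CommutativeSemigroupProperties +-commutativeSemigroup using () renaming (interchange to +-interchange)
  open GroupProperties +-group using (∙-cancelˡ)

  Σ<-cong : ∀ n {f g : ℕ → Carrier} → (∀ i → i < n → f i ≈ g i) → Σ< R n f ≈ Σ< R n g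
  Σ<-cong zero    f≈g = refl
  Σ<-cong (suc n) f≈g = +-cong (Σ<-cong n (λ i i<n → f≈g i (m<n⇒m<1+n i<n))) (f≈g n ≤-refl)

  Σ<-cong′ : ∀ n {f g : ℕ → Carrier} → (∀ i → f i ≈ g i) → Σ< R n f ≈ Σ< R n g
  Σ<-cong′ n f≈g = Σ<-cong n (λ i _ → f≈g i)

  Σ<-≈0 : ∀ n {f : ℕ → Carrier} → (∀ i → i < n → f i ≈ 0#) → Σ< R n f ≈ 0#
  Σ<-≈0 zero    f≈0 = refl
  Σ<-≈0 (suc n) f≈0 =
    trans (+-cong (Σ<-≈0 n (λ i i<n → f≈0 i (m<n⇒m<1+n i<n))) (f≈0 n ≤-refl)) (+-identityʳ 0#)

  Σ<-distrib-+ : ∀ n (f g : ℕ → Carrier) → Σ< R n (λ i → f i + g i) ≈ Σ< R n f + Σ< R n g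
  Σ<-distrib-+ zero    f g = sym (+-identityʳ 0#)
  Σ<-distrib-+ (suc n) f g = trans (+-congʳ (Σ<-distrib-+ n f g)) (+-interchange _ _ _ _)

  *-distribˡ-Σ< : ∀ n x (f : ℕ → Carrier) → x * Σ< R n f ≈ Σ< R n (λ i → x * f i)
  *-distribˡ-Σ< zero    x f = zeroʳ x
  *-distribˡ-Σ< (suc n) x f = trans (distribˡ x _ _) (+-congʳ (*-distribˡ-Σ< n x f))

  *-distribʳ-Σ< : ∀ n x (f : ℕ → Carrier) → Σ< R n f * x ≈ Σ< R n (λ i → f i * x)
  *-distribʳ-Σ< zero    x f = zeroˡ x
  *-distribʳ-Σ< (suc n) x f = trans (distribʳ x _ _) (+-congʳ (*-distribʳ-Σ< n x f))

  Σ<-head : ∀ n (f : ℕ → Carrier) → Σ< R (suc n) f ≈ f 0 + Σ< R n (λ i → f (suc i))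
  Σ<-head zero    f = trans (+-identityˡ _) (sym (+-identityʳ _))
  Σ<-head (suc n) f = trans (+-congʳ (Σ<-head n f)) (+-assoc _ _ _)

  Σ<-comm : ∀ n m (f : ℕ → ℕ → Carrier) →
            Σ< R n (λ i → Σ< R m (f i)) ≈ Σ< R m (λ j → Σ< R n (λ i → f i j))
  Σ<-comm zero    m f = sym (Σ<-≈0 m (λ _ _ → refl))
  Σ<-comm (suc n) m f = trans (+-congʳ (Σ<-comm n m f)) (sym (Σ<-distrib-+ m _ _))

  Σ<-reverse : ∀ n (f : ℕ → Carrier) → Σ< R n f ≈ Σ< R n (λ i → f (n ∸ suc i))
  Σ<-reverse zero    f = refl
  Σ<-reverse (suc n) f = begin
    Σ< R n f + f n                         ≈⟨ +-comm _ _ ⟩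
    f n + Σ< R n f                         ≈⟨ +-congˡ (Σ<-reverse n f) ⟩
    f n + Σ< R n (λ i → f (n ∸ suc i))    ≈⟨ Σ<-head n _ ⟨
    Σ< R (suc n) (λ i → f (n ∸ i))        ∎

  Σ<-extend : ∀ {n m} {f : ℕ → Carrier} → n ≤ m → (∀ i → n ≤ i → f i ≈ 0#) →
              Σ< R m f ≈ Σ< R n f
  Σ<-extend {n} {f = f} n≤m f≈0 = go (≤⇒≤′ n≤m)
    where
    go : ∀ {m} → n ≤′ m → Σ< R m f ≈ Σ< R n f
    go ≤′-refl          = refl
    go (≤′-step {m} n≤′m) = trans (+-cong (go n≤′m) (f≈0 m (≤′⇒≤ n≤′m))) (+-identityʳ _)

  Σ<-tail-irrelevant : ∀ n m {f : ℕ → Carrier} →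
                       (∀ i → n ≤ i → f i ≈ 0#) → (∀ i → m ≤ i → f i ≈ 0#) → Σ< R n f ≈ Σ< R m f
  Σ<-tail-irrelevant n m f≈0ₙ f≈0ₘ with ≤-total n m
  ... | inj₁ n≤m = sym (Σ<-extend n≤m f≈0ₙ)
  ... | inj₂ m≤n = Σ<-extend m≤n f≈0ₘ

  Σ<-triangle : ∀ N (h : ℕ → ℕ → Carrier) →
                Σ< R N (λ k → Σ< R (suc k) (λ i → h i (k ∸ i))) ≈ Σ< R N (λ i → Σ< R (N ∸ i) (h i))
  Σ<-triangle zero    h = refl
  Σ<-triangle (suc N) h = begin
    Σ< R N (λ k → Σ< R (suc k) (λ i → h i (k ∸ i))) + Σ< R (suc N) (λ i → h i (N ∸ i))
      ≈⟨ +-congʳ (Σ<-triangle N h) ⟩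
    Σ< R N (λ i → Σ< R (N ∸ i) (h i)) + Σ< R (suc N) (λ i → h i (N ∸ i))
      ≈⟨ +-congʳ (trans (+-congˡ (reflexive (≡.cong (λ l → Σ< R l (h N)) (n∸n≡0 N))))
                        (+-identityʳ _)) ⟨
    (Σ< R N (λ i → Σ< R (N ∸ i) (h i)) + Σ< R (N ∸ N) (h N)) + Σ< R (suc N) (λ i → h i (N ∸ i))
      ≈⟨ Σ<-distrib-+ (suc N) _ _ ⟨
    Σ< R (suc N) (λ i → Σ< R (N ∸ i) (h i) + h i (N ∸ i))
      ≈⟨ Σ<-cong (suc N) (λ i i<1+N →
           reflexive (≡.cong (λ l → Σ< R l (h i)) (+-∸-assoc 1 (≤-pred i<1+N)))) ⟨
    Σ< R (suc N) (λ i → Σ< R (suc N ∸ i) (h i))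
      ∎

  infix  4 _≈ₛ_
  infixl 6 _+ₛ_
  infixl 7 _*ₛ_

  _≈ₛ_ : Series R → Series R → Set ℓ
  F ≈ₛ G = ∀ n → F n ≈ G n

  _+ₛ_ : Series R → Series R → Series R
  (F +ₛ G) n = F n + G n

  _*ₛ_ : Series R → Series R → Series R
  _*ₛ_ = _⊛_ R

  1ₛ : Series R
  1ₛ = oneS R

  ConstFree : Series R → Set ℓ
  ConstFree F = F 0 ≈ 0#

  *ₛ-cong : ∀ {F F′ G G′} → F ≈ₛ F′ → G ≈ₛ G′ → F *ₛ G ≈ₛ F′ *ₛ G′
  *ₛ-cong F≈F′ G≈G′ n = Σ<-cong′ (suc n) (λ i → *-cong (F≈F′ i) (G≈G′ (n ∸ i)))

  *ₛ-comm : ∀ F G → F *ₛ G ≈ₛ G *ₛ F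
  *ₛ-comm F G n = trans (Σ<-reverse (suc n) _) (Σ<-cong (suc n) (λ i i<1+n →
    trans (*-comm _ _) (*-congʳ (reflexive (≡.cong G (m∸[m∸n]≡n (≤-pred i<1+n)))))))

  *ₛ-distribʳ-+ₛ : ∀ F G H → (F +ₛ G) *ₛ H ≈ₛ F *ₛ H +ₛ G *ₛ H
  *ₛ-distribʳ-+ₛ F G H n = trans (Σ<-cong′ (suc n) (λ i → distribʳ _ _ _)) (Σ<-distrib-+ (suc n) _ _)

  *ₛ-assoc : ∀ F G H → (F *ₛ G) *ₛ H ≈ₛ F *ₛ (G *ₛ H)
  *ₛ-assoc F G H n = begin
    Σ< R (suc n) (λ k → Σ< R (suc k) (λ i → F i * G (k ∸ i)) * H (n ∸ k))
      ≈⟨ Σ<-cong′ (suc n) (λ k → *-distribʳ-Σ< (suc k) _ _) ⟩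
    Σ< R (suc n) (λ k → Σ< R (suc k) (λ i → (F i * G (k ∸ i)) * H (n ∸ k)))
      ≈⟨ Σ<-cong′ (suc n) (λ k → Σ<-cong (suc k) (λ i i<1+k → trans (*-assoc _ _ _)
           (*-congˡ (*-congˡ (reflexive (≡.cong (λ l → H (n ∸ l)) (≡.sym (m+[n∸m]≡n (≤-pred i<1+k))))))))) ⟩
    Σ< R (suc n) (λ k → Σ< R (suc k) (λ i → h i (k ∸ i)))
      ≈⟨ Σ<-triangle (suc n) h ⟩
    Σ< R (suc n) (λ i → Σ< R (suc n ∸ i) (h i))
      ≈⟨ Σ<-cong (suc n) row ⟩
    Σ< R (suc n) (λ i → F i * (G *ₛ H) (n ∸ i))
      ∎
    where
    h : ℕ → ℕ → Carrier
    h i j = F i * (G j * H (n ∸ (i +ℕ j)))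

    row : ∀ i → i < suc n → Σ< R (suc n ∸ i) (h i) ≈ F i * (G *ₛ H) (n ∸ i)
    row i i<1+n = begin
      Σ< R (suc n ∸ i) (h i)
        ≡⟨ ≡.cong (λ l → Σ< R l (h i)) (+-∸-assoc 1 (≤-pred i<1+n)) ⟩
      Σ< R (suc (n ∸ i)) (h i)
        ≈⟨ Σ<-cong′ (suc (n ∸ i)) (λ j → *-congˡ (*-congˡ (reflexive (≡.cong H (∸-+-assoc n i j))))) ⟨
      Σ< R (suc (n ∸ i)) (λ j → F i * (G j * H (n ∸ i ∸ j)))
        ≈⟨ *-distribˡ-Σ< (suc (n ∸ i)) (F i) _ ⟨
      F i * (G *ₛ H) (n ∸ i)
        ∎

  *ₛ-identityˡ : ∀ F → 1ₛ *ₛ F ≈ₛ F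
  *ₛ-identityˡ F n = trans (Σ<-head n _)
    (trans (+-cong (*-identityˡ _) (Σ<-≈0 n (λ i _ → zeroˡ _))) (+-identityʳ _))

  *ₛ-identityʳ : ∀ F → F *ₛ 1ₛ ≈ₛ F
  *ₛ-identityʳ F n = trans (*ₛ-comm F 1ₛ n) (*ₛ-identityˡ F n)

  ConstFree⇒*ₛ-coeff : ∀ {F} → ConstFree F → ∀ G m →
                       (F *ₛ G) m ≈ Σ< R m (λ i → F (suc i) * G (m ∸ suc i))
  ConstFree⇒*ₛ-coeff F₀≈0 G m =
    trans (Σ<-head m _) (trans (+-congʳ (trans (*-congʳ F₀≈0) (zeroˡ _))) (+-identityˡ _))

  ConstFree⇒powS-vanishes : ∀ {F} → ConstFree F → ∀ k m → m < k → powS R F k m ≈ 0#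
  ConstFree⇒powS-vanishes {F} F₀≈0 (suc k) m (s≤s m≤k) =
    trans (ConstFree⇒*ₛ-coeff F₀≈0 (powS R F k) m) (Σ<-≈0 m (λ i i<m →
      trans (*-congˡ (ConstFree⇒powS-vanishes F₀≈0 k (m ∸ suc i) (<-≤-trans (m∸1+n<m i<m) m≤k)))
            (zeroʳ _)))

  powS-+ : ∀ F i j → powS R F (i +ℕ j) ≈ₛ powS R F i *ₛ powS R F j
  powS-+ F zero    j n = sym (*ₛ-identityˡ (powS R F j) n)
  powS-+ F (suc i) j n = trans (*ₛ-cong (λ _ → refl) (powS-+ F i j) n)
                               (sym (*ₛ-assoc F (powS R F i) (powS R F j) n))

  powS-cong-≤ : ∀ {F G} m → (∀ i → i ≤ m → F i ≈ G i) →
                ∀ k j → j ≤ m → powS R F k j ≈ powS R G k j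
  powS-cong-≤ m F≈G zero    j _   = refl
  powS-cong-≤ m F≈G (suc k) j j≤m = Σ<-cong (suc j) (λ i i<1+j →
    *-cong (F≈G i (≤-trans (≤-pred i<1+j) j≤m))
           (powS-cong-≤ m F≈G k (j ∸ i) (≤-trans (m∸n≤m j i) j≤m)))

  fixpoint-unique : ∀ {Q X Y} → ConstFree Q → X ≈ₛ Q +ₛ Q *ₛ X → Y ≈ₛ Q +ₛ Q *ₛ Y → X ≈ₛ Y
  fixpoint-unique {Q} {X} {Y} Q₀≈0 X-fix Y-fix = <-rec (λ m → X m ≈ Y m) step
    where
    step : ∀ m → (∀ {i} → i < m → X i ≈ Y i) → X m ≈ Y m
    step m X≈Y-below = begin
      X m                                                  ≈⟨ X-fix m ⟩
      Q m + (Q *ₛ X) m                                     ≈⟨ +-congˡ (ConstFree⇒*ₛ-coeff Q₀≈0 X m) ⟩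
      Q m + Σ< R m (λ i → Q (suc i) * X (m ∸ suc i))       ≈⟨ +-congˡ (Σ<-cong m (λ i i<m →
                                                                *-congˡ (X≈Y-below (m∸1+n<m i<m)))) ⟩
      Q m + Σ< R m (λ i → Q (suc i) * Y (m ∸ suc i))       ≈⟨ +-congˡ (ConstFree⇒*ₛ-coeff Q₀≈0 Y m) ⟨
      Q m + (Q *ₛ Y) m                                     ≈⟨ Y-fix m ⟨
      Y m                                                  ∎

  zPow : ℕ → Series R → Series R
  zPow zero    F = F
  zPow (suc k) F = zTimes R (zPow k F)

  zTimes-cong : ∀ {F G} → F ≈ₛ G → zTimes R F ≈ₛ zTimes R G
  zTimes-cong F≈G zero    = refl
  zTimes-cong F≈G (suc n) = F≈G n

  zTimes-*ₛˡ : ∀ F G → zTimes R F *ₛ G ≈ₛ zTimes R (F *ₛ G)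
  zTimes-*ₛˡ F G zero    = ConstFree⇒*ₛ-coeff {zTimes R F} refl G 0
  zTimes-*ₛˡ F G (suc n) = ConstFree⇒*ₛ-coeff {zTimes R F} refl G (suc n)

  zTimes-*ₛʳ : ∀ F G → F *ₛ zTimes R G ≈ₛ zTimes R (F *ₛ G)
  zTimes-*ₛʳ F G n = begin
    (F *ₛ zTimes R G) n     ≈⟨ *ₛ-comm F (zTimes R G) n ⟩
    (zTimes R G *ₛ F) n     ≈⟨ zTimes-*ₛˡ G F n ⟩
    zTimes R (G *ₛ F) n     ≈⟨ zTimes-cong (*ₛ-comm G F) n ⟩
    zTimes R (F *ₛ G) n     ∎

  zPow-*ₛʳ : ∀ k F G → F *ₛ zPow k G ≈ₛ zPow k (F *ₛ G)
  zPow-*ₛʳ zero    F G n = refl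
  zPow-*ₛʳ (suc k) F G n = trans (zTimes-*ₛʳ F (zPow k G) n) (zTimes-cong (zPow-*ₛʳ k F G) n)

  zPow-coeff : ∀ k F m → zPow k F m ≡ (if k ≤ᵇ m then F (m ∸ k) else 0#)
  zPow-coeff zero    F m       = ≡.refl
  zPow-coeff (suc k) F zero    = ≡.refl
  zPow-coeff (suc k) F (suc m) =
    ≡.trans (zPow-coeff k F m) (≡.cong (λ b → if b then F (m ∸ k) else 0#) (≤ᵇ≡<ᵇ-suc k m))

  zPow-vanishes : ∀ k F m → m < k → zPow k F m ≈ 0#
  zPow-vanishes k F m m<k = reflexive (≡.trans (zPow-coeff k F m) (if-false (<⇒≱ m<k ∘ ≤ᵇ⇒≤ k m)))

  powS-zTimes : ∀ F k → powS R (zTimes R F) k ≈ₛ zPow k (powS R F k)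
  powS-zTimes F zero    n = refl
  powS-zTimes F (suc k) n = begin
    (zTimes R F *ₛ powS R (zTimes R F) k) n    ≈⟨ *ₛ-cong {zTimes R F} (λ _ → refl) (powS-zTimes F k) n ⟩
    (zTimes R F *ₛ zPow k (powS R F k)) n      ≈⟨ zTimes-*ₛˡ F (zPow k (powS R F k)) n ⟩
    zTimes R (F *ₛ zPow k (powS R F k)) n      ≈⟨ zTimes-cong (zPow-*ₛʳ k F (powS R F k)) n ⟩
    zTimes R (zPow k (powS R F (suc k))) n     ∎

  geometric : Series R → Series R
  geometric P n = Σ< R n (λ k → powS R P (suc k) n)

  geometric-truncate : ∀ {P} → ConstFree P → ∀ {m N} → m ≤ N →
                       geometric P m ≈ Σ< R N (λ k → powS R P (suc k) m)
  geometric-truncate P₀≈0 m≤N =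
    sym (Σ<-extend m≤N (λ k m≤k → ConstFree⇒powS-vanishes P₀≈0 (suc k) _ (s≤s m≤k)))

  geometric-fixpoint : ∀ {P} → ConstFree P → geometric P ≈ₛ P +ₛ P *ₛ geometric P
  geometric-fixpoint {P} P₀≈0 n = begin
    geometric P n
      ≈⟨ geometric-truncate P₀≈0 (n≤1+n n) ⟩
    Σ< R (suc n) (λ k → powS R P (suc k) n)
      ≈⟨ Σ<-head n _ ⟩
    (P *ₛ 1ₛ) n + Σ< R n (λ k → Σ< R (suc n) (λ i → P i * powS R P (suc k) (n ∸ i)))
      ≈⟨ +-cong (*ₛ-identityʳ P n) (Σ<-comm n (suc n) _) ⟩
    P n + Σ< R (suc n) (λ i → Σ< R n (λ k → P i * powS R P (suc k) (n ∸ i)))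
      ≈⟨ +-congˡ (Σ<-cong′ (suc n) (λ i → *-distribˡ-Σ< n (P i) _)) ⟨
    P n + Σ< R (suc n) (λ i → P i * Σ< R n (λ k → powS R P (suc k) (n ∸ i)))
      ≈⟨ +-congˡ (Σ<-cong′ (suc n) (λ i → *-congˡ (geometric-truncate P₀≈0 (m∸n≤m n i)))) ⟨
    P n + (P *ₛ geometric P) n
      ∎

  compose-cong : ∀ {F G} W → F ≈ₛ G → compose R F W ≈ₛ compose R G W
  compose-cong W F≈G n = Σ<-cong′ (suc n) (λ k → *-congʳ (F≈G k))

  compose-homo-+ₛ : ∀ F G W → compose R (F +ₛ G) W ≈ₛ compose R F W +ₛ compose R G W
  compose-homo-+ₛ F G W n = trans (Σ<-cong′ (suc n) (λ k → distribʳ _ _ _)) (Σ<-distrib-+ (suc n) _ _)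

  compose-constFree : ∀ {F} W → ConstFree F → ConstFree (compose R F W)
  compose-constFree W F₀≈0 = trans (+-identityˡ _) (trans (*-congʳ F₀≈0) (zeroˡ _))

  module _ {W : Series R} (W₀≈0 : ConstFree W) where

    compose-truncate : ∀ F {n N} → n < N → compose R F W n ≈ Σ< R N (λ k → F k * powS R W k n)
    compose-truncate F n<N = sym (Σ<-extend n<N (λ k n<k →
      trans (*-congˡ (ConstFree⇒powS-vanishes W₀≈0 k _ n<k)) (zeroʳ _)))

    compose-*ₛ-expand : ∀ F G n →
      (compose R F W *ₛ G) n ≈ Σ< R (suc n) (λ k → F k * (powS R W k *ₛ G) n)
    compose-*ₛ-expand F G n = begin
      Σ< R (suc n) (λ m → compose R F W m * G (n ∸ m))
        ≈⟨ Σ<-cong (suc n) (λ m m<1+n → *-congʳ (compose-truncate F m<1+n)) ⟩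
      Σ< R (suc n) (λ m → Σ< R (suc n) (λ k → F k * powS R W k m) * G (n ∸ m))
        ≈⟨ Σ<-cong′ (suc n) (λ m → *-distribʳ-Σ< (suc n) _ _) ⟩
      Σ< R (suc n) (λ m → Σ< R (suc n) (λ k → F k * powS R W k m * G (n ∸ m)))
        ≈⟨ Σ<-comm (suc n) (suc n) _ ⟩
      Σ< R (suc n) (λ k → Σ< R (suc n) (λ m → F k * powS R W k m * G (n ∸ m)))
        ≈⟨ Σ<-cong′ (suc n) (λ k → trans (Σ<-cong′ (suc n) (λ m → *-assoc _ _ _))
                                         (sym (*-distribˡ-Σ< (suc n) (F k) _))) ⟩
      Σ< R (suc n) (λ k → F k * (powS R W k *ₛ G) n)
        ∎

    compose-*ₛ-double-sum : ∀ F G n → compose R (F *ₛ G) W n ≈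
      Σ< R (suc n) (λ i → F i * Σ< R (suc n) (λ j → G j * powS R W (j +ℕ i) n))
    compose-*ₛ-double-sum F G n = begin
      Σ< R N (λ k → Σ< R (suc k) (λ i → F i * G (k ∸ i)) * powS R W k n)
        ≈⟨ Σ<-cong′ N (λ k → *-distribʳ-Σ< (suc k) _ _) ⟩
      Σ< R N (λ k → Σ< R (suc k) (λ i → F i * G (k ∸ i) * powS R W k n))
        ≈⟨ Σ<-cong′ N (λ k → Σ<-cong (suc k) (λ i i<1+k → trans (*-assoc _ _ _) (*-congˡ (*-congˡ
             (reflexive (≡.cong (λ l → powS R W l n) (≡.sym (m∸n+n≡m (≤-pred i<1+k))))))))) ⟩
      Σ< R N (λ k → Σ< R (suc k) (λ i → h i (k ∸ i)))
        ≈⟨ Σ<-triangle N h ⟩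
      Σ< R N (λ i → Σ< R (N ∸ i) (h i))
        ≈⟨ Σ<-cong N (λ i i<N → Σ<-extend (m∸n≤m N i) (λ j N∸i≤j →
             trans (*-congˡ (trans (*-congˡ (ConstFree⇒powS-vanishes W₀≈0 (j +ℕ i) n
               (≤-trans (≤-reflexive (≡.sym (m∸n+n≡m (<⇒≤ i<N)))) (+-monoˡ-≤ i N∸i≤j))))
               (zeroʳ _))) (zeroʳ _))) ⟨
      Σ< R N (λ i → Σ< R N (h i))
        ≈⟨ Σ<-cong′ N (λ i → *-distribˡ-Σ< N (F i) _) ⟨
      Σ< R N (λ i → F i * Σ< R N (λ j → G j * powS R W (j +ℕ i) n))
        ∎
      where
      N = suc n
      h : ℕ → ℕ → Carrier
      h i j = F i * (G j * powS R W (j +ℕ i) n)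

    *ₛ-compose-double-sum : ∀ F G n → (compose R F W *ₛ compose R G W) n ≈
      Σ< R (suc n) (λ i → F i * Σ< R (suc n) (λ j → G j * powS R W (j +ℕ i) n))
    *ₛ-compose-double-sum F G n = begin
      (compose R F W *ₛ compose R G W) n
        ≈⟨ compose-*ₛ-expand F (compose R G W) n ⟩
      Σ< R (suc n) (λ i → F i * (powS R W i *ₛ compose R G W) n)
        ≈⟨ Σ<-cong′ (suc n) (λ i → *-congˡ
             (trans (*ₛ-comm _ _ n) (compose-*ₛ-expand G (powS R W i) n))) ⟩
      Σ< R (suc n) (λ i → F i * Σ< R (suc n) (λ j → G j * (powS R W j *ₛ powS R W i) n))
        ≈⟨ Σ<-cong′ (suc n) (λ i → *-congˡ (Σ<-cong′ (suc n) (λ j → *-congˡ (powS-+ W j i n)))) ⟨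
      Σ< R (suc n) (λ i → F i * Σ< R (suc n) (λ j → G j * powS R W (j +ℕ i) n))
        ∎

    compose-homo-*ₛ : ∀ F G → compose R (F *ₛ G) W ≈ₛ compose R F W *ₛ compose R G W
    compose-homo-*ₛ F G n = trans (compose-*ₛ-double-sum F G n) (sym (*ₛ-compose-double-sum F G n))

  compose-zTimes-*ₛ : ∀ F G N → (compose R F (zTimes R G) *ₛ G) N ≈
                      Σ< R (suc N) (λ k → F k * zPow k (powS R G (suc k)) N)
  compose-zTimes-*ₛ F G N = trans (compose-*ₛ-expand {zTimes R G} refl F G N) (Σ<-cong′ (suc N) (λ k →
    *-congˡ (begin
      (powS R (zTimes R G) k *ₛ G) N        ≈⟨ *ₛ-cong {G = G} (powS-zTimes G k) (λ _ → refl) N ⟩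
      (zPow k (powS R G k) *ₛ G) N          ≈⟨ *ₛ-comm (zPow k (powS R G k)) G N ⟩
      (G *ₛ zPow k (powS R G k)) N          ≈⟨ zPow-*ₛʳ k G (powS R G k) N ⟩
      zPow k (powS R G (suc k)) N           ∎)))

  if-then-cong : ∀ b {x y z} → x ≈ y → (if b then x else z) ≈ (if b then y else z)
  if-then-cong true  x≈y = x≈y
  if-then-cong false _   = refl

  Pa-coeff : ∀ r a {i} → i < r ∸ 1 → Pa R r a (suc i) ≡ a (suc (suc i))
  Pa-coeff (suc r′) a i<r′ = if-true (<⇒<ᵇ i<r′)

  Pa-degree : ∀ r a {k} → r ∸ 1 < k → Pa R r a k ≈ 0#
  Pa-degree zero     a {suc m} _          = refl
  Pa-degree (suc r′) a {suc m} (s≤s r′≤m) = reflexive (if-false (≤⇒≯ r′≤m ∘ <ᵇ⇒< m r′))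

  cTab-stable : ∀ r a {m n} → m ≤ n → cTab R r a n m ≡ cSeq R r a m
  cTab-stable r a m≤n = go (≤⇒≤′ m≤n)
    where
    go : ∀ {m n} → m ≤′ n → cTab R r a n m ≡ cSeq R r a m
    go ≤′-refl          = ≡.refl
    go (≤′-step m≤′n) = ≡.trans (if-true (≤⇒≤ᵇ (≤′⇒≤ m≤′n))) (go m≤′n)

  cSeq-suc : ∀ r a n → cSeq R r a (suc n) ≡ cStep R r a (cTab R r a n) (suc n)
  cSeq-suc r a n = if-false (n≮n n ∘ ≤ᵇ⇒≤ (suc n) n)

  module Sequence (r : ℕ) (a : ℕ → Carrier) where

    C P W Q C₊ : Series R
    C  = cSeq R r a
    P  = Pa R r a
    W  = zTimes R C
    Q  = compose R P W
    C₊ = zTimes R (λ n → C (suc n))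

    Q-constFree : ConstFree Q
    Q-constFree = compose-constFree {P} W refl

    C*Q-coeff : ∀ N →
      (C *ₛ Q) N ≈ Σ< R (r ∸ 1) (λ i → P (suc i) * zPow (suc i) (powS R C (suc (suc i))) N)
    C*Q-coeff N = begin
      (C *ₛ Q) N
        ≈⟨ *ₛ-comm C Q N ⟩
      (Q *ₛ C) N
        ≈⟨ compose-zTimes-*ₛ P C N ⟩
      Σ< R (suc N) f
        ≈⟨ Σ<-tail-irrelevant (suc N) (suc (r ∸ 1))
             (λ k N<k → trans (*-congˡ (zPow-vanishes k _ N N<k)) (zeroʳ _))
             (λ k r∸1<k → trans (*-congʳ (Pa-degree r a r∸1<k)) (zeroˡ _)) ⟩
      Σ< R (suc (r ∸ 1)) f
        ≈⟨ Σ<-head (r ∸ 1) f ⟩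
      f 0 + Σ< R (r ∸ 1) (λ i → f (suc i))
        ≈⟨ trans (+-congʳ (zeroˡ _)) (+-identityˡ _) ⟩
      Σ< R (r ∸ 1) (λ i → f (suc i))
        ∎
      where
      f : ℕ → Carrier
      f k = P k * zPow k (powS R C (suc k)) N

    -- The guards of cStep and of zPow-coeff (suc i) both reduce to i <ᵇ suc n.
    cStep-summand : ∀ n {i} → i < r ∸ 1 →
      a (suc (suc i)) * (if suc (suc i) ≤ᵇ suc (suc n) then powS R (cTab R r a n) (suc (suc i)) (n ∸ i) else 0#)
        ≈ P (suc i) * zPow (suc i) (powS R C (suc (suc i))) (suc n)
    cStep-summand n {i} i<r∸1 = *-cong (reflexive (≡.sym (Pa-coeff r a i<r∸1))) (begin
      (if suc i ≤ᵇ suc n then powS R (cTab R r a n) (suc (suc i)) (n ∸ i) else 0#)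
        ≈⟨ if-then-cong (suc i ≤ᵇ suc n) (powS-cong-≤ n (λ j j≤n → reflexive (cTab-stable r a j≤n))
                                                      (suc (suc i)) (n ∸ i) (m∸n≤m n i)) ⟩
      (if suc i ≤ᵇ suc n then powS R C (suc (suc i)) (n ∸ i) else 0#)
        ≡⟨ zPow-coeff (suc i) (powS R C (suc (suc i))) (suc n) ⟨
      zPow (suc i) (powS R C (suc (suc i))) (suc n)
        ∎)

    cSeq-recursion : C ≈ₛ 1ₛ +ₛ C *ₛ Q
    cSeq-recursion zero = sym (trans (+-congˡ (trans (*ₛ-comm C Q 0) (ConstFree⇒*ₛ-coeff {Q} Q-constFree C 0)))
                                     (+-identityʳ 1#))
    cSeq-recursion (suc n) = begin
      C (suc n)
        ≡⟨ cSeq-suc r a n ⟩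
      cStep R r a (cTab R r a n) (suc n)
        ≈⟨ Σ<-cong (r ∸ 1) (λ i → cStep-summand n) ⟩
      Σ< R (r ∸ 1) (λ i → P (suc i) * zPow (suc i) (powS R C (suc (suc i))) (suc n))
        ≈⟨ C*Q-coeff (suc n) ⟨
      (C *ₛ Q) (suc n)
        ≈⟨ +-identityˡ _ ⟨
      (1ₛ +ₛ C *ₛ Q) (suc n)
        ∎

    C≈1+C₊ : C ≈ₛ 1ₛ +ₛ C₊
    C≈1+C₊ zero    = sym (+-identityʳ 1#)
    C≈1+C₊ (suc n) = sym (+-identityˡ _)

    C₊-fixpoint : C₊ ≈ₛ Q +ₛ Q *ₛ C₊
    C₊-fixpoint n = begin
      C₊ n                        ≈⟨ ∙-cancelˡ (1ₛ n) _ _ (trans (sym (C≈1+C₊ n)) (cSeq-recursion n)) ⟩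
      (C *ₛ Q) n                  ≈⟨ *ₛ-cong {G = Q} C≈1+C₊ (λ _ → refl) n ⟩
      ((1ₛ +ₛ C₊) *ₛ Q) n         ≈⟨ *ₛ-distribʳ-+ₛ 1ₛ C₊ Q n ⟩
      (1ₛ *ₛ Q) n + (C₊ *ₛ Q) n   ≈⟨ +-cong (*ₛ-identityˡ Q n) (*ₛ-comm C₊ Q n) ⟩
      Q n + (Q *ₛ C₊) n           ∎

    Ra∘W-fixpoint : compose R (Ra R r a) W ≈ₛ Q +ₛ Q *ₛ compose R (Ra R r a) W
    Ra∘W-fixpoint n = begin
      compose R (Ra R r a) W n                   ≈⟨ compose-cong W (geometric-fixpoint {P} refl) n ⟩
      compose R (P +ₛ P *ₛ Ra R r a) W n         ≈⟨ compose-homo-+ₛ P (P *ₛ Ra R r a) W n ⟩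
      Q n + compose R (P *ₛ Ra R r a) W n        ≈⟨ +-congˡ (compose-homo-*ₛ {W} refl P (Ra R r a) n) ⟩
      Q n + (Q *ₛ compose R (Ra R r a) W) n      ∎

    Ra-isRTransform : IsRTransform R C (Ra R r a)
    Ra-isRTransform = refl , λ n → begin
      1ₛ n + compose R (Ra R r a) W n
        ≈⟨ +-congˡ (fixpoint-unique Q-constFree Ra∘W-fixpoint C₊-fixpoint n) ⟩
      1ₛ n + C₊ n
        ≈⟨ C≈1+C₊ n ⟨
      C n
        ∎

proposition3p1 : ∀ {c ℓ} (R : CommutativeRing c ℓ) (r : ℕ) → 2 ≤ r →
    (a : ℕ → CommutativeRing.Carrier R) →
    ¬ (CommutativeRing._≈_ R (a r) (CommutativeRing.0# R)) →
    IsRTransform R (cSeq R r a) (Ra R r a)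
proposition3p1 R r _ a _ = FormalPowerSeries.Sequence.Ra-isRTransform R r a
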